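{- Let $\phi\colon\omega\to\mathbb{R}^+$ be given by $\phi(n)=2^n$, and let $d_\phi$ be the metric on $\omega^\omega$ defined by $d_\phi(x,y)=\max\{\phi(x(0)),\phi(y(0))\}\cdot\bar d(x,y)$. Then there is a function $f\colon\omega^\omega\to\omega^\omega$ which is nonexpansive with respect to $\bar d$ (i.e. $\bar d(f(x),f(y))\le\bar d(x,y)$ for all $x,y$) but is not uniformly continuous with respect to $d_\phi$. In other words, $\mathsf{L}(\bar d)\not\subseteq\mathsf{UCont}(d_\phi)$.
   Context: $\omega^\omega$ is the Baire space. $\bar d$ is its usual ultrametric: $\bar d(x,y)=0$ if $x=y$ and $\bar d(x,y)=2^{ -n}$ where $n$ is least with $x(n)\neq y(n)$. $\mathsf{L}(d)$ denotes the set of $d$-nonexpansive self-maps and $\mathsf{UCont}(d)$ the set of $d$-uniformly continuous self-maps (for every $\varepsilon>0$ there is $\delta>0$ such that $d(x,y)<\delta$ implies $d(f(x),f(y))<\varepsilon$). For $\phi$ with $\inf\operatorname{rg}(\phi)>0$, $d_\phi$ is a complete ultrametric compatible with the product topology. -}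

module Defs where

open import Data.Nat using (ℕ; zero; suc; _<_; _⊔_)
open import Data.Integer using (+_)
open import Data.Rational using (ℚ; 0ℚ; 1ℚ; ½; _*_; _/_) renaming (_≤_ to _≤ℚ_; _<_ to _<ℚ_)
open import Data.Product using (Σ; _×_; ∃)
open import Data.Sum using (_⊎_)
open import Relation.Binary.PropositionalEquality using (_≡_; _≢_)

Baire : Set
Baire = ℕ → ℕ

_^ℚ_ : ℚ → ℕ → ℚ
q ^ℚ zero  = 1ℚ
q ^ℚ suc n = q * (q ^ℚ n)

FirstDiff : Baire → Baire → ℕ → Set
FirstDiff x y n = (∀ i → i < n → x i ≡ y i) × (x n ≢ y n)

-- DBar x y r : "the usual ultrametric d̄(x,y) equals r"
-- d̄(x,y) = 0 if x = y, and 2^{-n} where n is least with x(n) ≠ y(n).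
DBar : Baire → Baire → ℚ → Set
DBar x y r = ((∀ i → x i ≡ y i) × (r ≡ 0ℚ))
           ⊎ ∃ (λ n → FirstDiff x y n × (r ≡ ½ ^ℚ n))

φ : ℕ → ℚ
φ n = (+ 2 / 1) ^ℚ n

-- Dφ x y r : "d_φ(x,y) = max{φ(x0),φ(y0)} · d̄(x,y) equals r"
-- (φ is monotone, so max{φ(x0),φ(y0)} = φ(max{x0,y0}))
Dφ : Baire → Baire → ℚ → Set
Dφ x y r = Σ ℚ (λ s → DBar x y s × (r ≡ φ (x 0 ⊔ y 0) * s))

Nonexpansive : (Baire → Baire → ℚ → Set) → (Baire → Baire) → Set
Nonexpansive d f = ∀ x y r s → d x y r → d (f x) (f y) s → s ≤ℚ r

UniformlyContinuous : (Baire → Baire → ℚ → Set) → (Baire → Baire) → Set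
UniformlyContinuous d f =
  ∀ ε → 0ℚ <ℚ ε → Σ ℚ (λ δ → 0ℚ <ℚ δ ×
    (∀ x y r s → d x y r → d (f x) (f y) s → r <ℚ δ → s <ℚ ε))

module Submission where

-- The map F replaces the head x(0) by x(0) + x(0) + 1 and leaves the tail
-- alone.  Because it acts coordinatewise by injective maps, F preserves the
-- first index at which two sequences differ, so it is a d̄-isometry.
-- For uniform continuity, fix b and let x be constantly b and y agree with x
-- exactly below k = b + (b + 1).  Both pairs (x, y) and (F x, F y) first
-- differ at k, but the heads are b resp. k, so
--   d_φ(x, y) = 2ᵇ · 2⁻ᵏ = 2⁻⁽ᵇ⁺¹⁾   while   d_φ(F x, F y) = 2ᵏ · 2⁻ᵏ = 1.
-- Since 2⁻⁽ᵇ⁺¹⁾ eventually drops below any δ > 0, no δ works for ε = 1.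

open import Defs
open import Data.Product using (Σ; _×_; _,_; proj₁)
open import Data.Sum using (inj₁; inj₂)
open import Data.Empty using (⊥-elim)
open import Relation.Nullary using (¬_)
open import Relation.Binary using (tri<; tri≈; tri>)
open import Relation.Binary.PropositionalEquality
open import Function.Definitions using (Injective)
open import Algebra.Bundles using (CommutativeMonoid)
open import Data.Nat as ℕ using (ℕ; zero; suc; _+_; _∸_; _⊔_; z≤n; s≤s)
import Data.Nat.Properties as ℕP
open import Data.Integer as ℤ using (+_; +[1+_]; -[1+_]; +<+)
import Data.Integer.Properties as ℤP
open import Data.Rational as ℚ using (ℚ; mkℚ; 0ℚ; 1ℚ; ½; _*_; toℚᵘ; *<*)
import Data.Rational.Properties as ℚP
open import Data.Rational.Unnormalised as ℚᵘ using (ℚᵘ; mkℚᵘ)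
import Data.Rational.Unnormalised.Properties as ℚᵘP
open import Algebra.Properties.CommutativeSemigroup
  (CommutativeMonoid.commutativeSemigroup ℚP.*-1-commutativeMonoid)
  using (interchange)

^-+ : ∀ q m n → q ^ℚ (m + n) ≡ (q ^ℚ m) * (q ^ℚ n)
^-+ q zero    n = sym (ℚP.*-identityˡ _)
^-+ q (suc m) n = trans (cong (q *_) (^-+ q m n)) (sym (ℚP.*-assoc q _ _))

^-distrib-* : ∀ p q n → (p * q) ^ℚ n ≡ (p ^ℚ n) * (q ^ℚ n)
^-distrib-* p q zero    = refl
^-distrib-* p q (suc n) =
  trans (cong ((p * q) *_) (^-distrib-* p q n)) (interchange p q _ _)

1^n≡1 : ∀ n → 1ℚ ^ℚ n ≡ 1ℚ
1^n≡1 zero    = refl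
1^n≡1 (suc n) = trans (ℚP.*-identityˡ _) (1^n≡1 n)

-- φ(n) · 2⁻ⁿ = (2 · ½)ⁿ = 1: this is why d_φ of two sequences with head n
-- first differing at n is exactly 1.
φ*½^n≡1 : ∀ n → φ n * (½ ^ℚ n) ≡ 1ℚ
φ*½^n≡1 n = trans (sym (^-distrib-* (+ 2 ℚ./ 1) ½ n)) (1^n≡1 n)

φ*½^[m+n]≡½^n : ∀ m n → φ m * (½ ^ℚ (m + n)) ≡ ½ ^ℚ n
φ*½^[m+n]≡½^n m n = begin
  φ m * (½ ^ℚ (m + n))             ≡⟨ cong (φ m *_) (^-+ ½ m n) ⟩
  φ m * ((½ ^ℚ m) * (½ ^ℚ n))      ≡⟨ sym (ℚP.*-assoc (φ m) _ _) ⟩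
  (φ m * (½ ^ℚ m)) * (½ ^ℚ n)      ≡⟨ cong (_* (½ ^ℚ n)) (φ*½^n≡1 m) ⟩
  1ℚ * (½ ^ℚ n)                    ≡⟨ ℚP.*-identityˡ _ ⟩
  ½ ^ℚ n                           ∎
  where open ≡-Reasoning

-- 2ⁿ − 1, defined so that ½ · 1/(1 + mersenne n) computes to
-- 1/(1 + mersenne (n + 1)) in unnormalised rationals.
mersenne : ℕ → ℕ
mersenne zero    = 0
mersenne (suc n) = mersenne n + suc (mersenne n + 0)

suc-mersenne : ∀ n → suc (mersenne n) ≡ 2 ℕ.^ n
suc-mersenne zero    = refl
suc-mersenne (suc n) = cong (2 ℕ.*_) (suc-mersenne n)

½^ᵘ : ℕ → ℚᵘ
½^ᵘ n = mkℚᵘ (+ 1) (mersenne n)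

½^≃½^ᵘ : ∀ n → toℚᵘ (½ ^ℚ n) ℚᵘ.≃ ½^ᵘ n
½^≃½^ᵘ zero    = ℚᵘP.≃-refl
½^≃½^ᵘ (suc n) = ℚᵘP.≃-trans (ℚP.toℚᵘ-homo-* ½ (½ ^ℚ n))
  (ℚᵘP.≃-trans (ℚᵘP.*-congˡ {ℚᵘ.½} (½^≃½^ᵘ n)) (ℚᵘ.*≡* refl))

n<2^n : ∀ n → n ℕ.< 2 ℕ.^ n
n<2^n zero    = s≤s z≤n
n<2^n (suc n) = subst (λ k → suc (suc n) ℕ.≤ 2 ℕ.^ n + k) (sym (ℕP.+-identityʳ _))
  (ℕP.+-mono-≤ (ℕP.≤-trans (s≤s z≤n) (n<2^n n)) (n<2^n n))

-- A positive fraction (1 + a)/(1 + d) exceeds 1/2^(1 + d), because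
-- 1 + d < 2^(1 + d) ≤ (1 + a) · 2^(1 + d).
½^ᵘ<pos : ∀ a d → ½^ᵘ (suc d) ℚᵘ.< mkℚᵘ +[1+ a ] d
½^ᵘ<pos a d = ℚᵘ.*<* (subst₂ ℤ._<_ (sym (ℤP.*-identityˡ (+ suc d)))
  (ℤP.pos-* (suc a) (suc (mersenne (suc d))))
  (+<+ (subst (λ k → suc d ℕ.< suc a ℕ.* k) (sym (suc-mersenne (suc d)))
    (ℕP.≤-trans (n<2^n (suc d)) (ℕP.m≤n*m (2 ℕ.^ suc d) (suc a))))))

½^-archimedean : ∀ δ → 0ℚ ℚ.< δ → Σ ℕ λ b → ½ ^ℚ suc b ℚ.< δ
½^-archimedean (mkℚ +[1+ a ] d _) _ = d , ℚP.toℚᵘ-cancel-<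
  (ℚᵘP.<-respˡ-≃ (ℚᵘP.≃-sym (½^≃½^ᵘ (suc d))) (½^ᵘ<pos a d))
½^-archimedean (mkℚ (+ zero) _ _) (*<* (+<+ ()))
½^-archimedean (mkℚ -[1+ _ ] _ _) (*<* ())

firstDiff-unique : ∀ {x y m n} → FirstDiff x y m → FirstDiff x y n → m ≡ n
firstDiff-unique {m = m} {n} (agreeₘ , differₘ) (agreeₙ , differₙ) with ℕP.<-cmp m n
... | tri< m<n _ _ = ⊥-elim (differₘ (agreeₙ m m<n))
... | tri≈ _ m≡n _ = m≡n
... | tri> _ _ n<m = ⊥-elim (differₙ (agreeₘ n n<m))

dBar-firstDiff : ∀ {x y n} → FirstDiff x y n → DBar x y (½ ^ℚ n)
dBar-firstDiff {n = n} fd = inj₂ (n , fd , refl)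

dφ-equalHeads : ∀ {x y s} → x 0 ≡ y 0 → DBar x y s → Dφ x y (φ (x 0) * s)
dφ-equalHeads {x} {y} {s} x₀≡y₀ dxy = s , dxy ,
  cong (λ m → φ m * s) (sym (trans (cong (x 0 ⊔_) (sym x₀≡y₀)) (ℕP.⊔-idem (x 0))))

coordinatewise : (ℕ → ℕ → ℕ) → Baire → Baire
coordinatewise g x i = g i (x i)

module _ (g : ℕ → ℕ → ℕ) (g-inj : ∀ i → Injective _≡_ _≡_ (g i)) where

  coordinatewise-firstDiff : ∀ {x y n} → FirstDiff x y n →
    FirstDiff (coordinatewise g x) (coordinatewise g y) n
  coordinatewise-firstDiff {n = n} (agree , differ) =
    (λ i i<n → cong (g i) (agree i i<n)) , (λ same → differ (g-inj n same))

  coordinatewise-nonexpansive : Nonexpansive DBar (coordinatewise g)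
  coordinatewise-nonexpansive x y r s (inj₁ (_ , r≡0)) (inj₁ (_ , s≡0)) =
    ℚP.≤-reflexive (trans s≡0 (sym r≡0))
  coordinatewise-nonexpansive x y r s (inj₁ (equal , _)) (inj₂ (n , (_ , differ) , _)) =
    ⊥-elim (differ (cong (g n) (equal n)))
  coordinatewise-nonexpansive x y r s (inj₂ (n , (_ , differ) , _)) (inj₁ (equal , _)) =
    ⊥-elim (differ (g-inj n (equal n)))
  coordinatewise-nonexpansive x y r s (inj₂ (n , fd , r≡)) (inj₂ (m , fd′ , s≡)) =
    ℚP.≤-reflexive (begin
      s          ≡⟨ s≡ ⟩
      ½ ^ℚ m     ≡⟨ cong (½ ^ℚ_) (firstDiff-unique fd′ (coordinatewise-firstDiff fd)) ⟩
      ½ ^ℚ n     ≡⟨ sym r≡ ⟩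
      r          ∎)
    where open ≡-Reasoning

strictlyIncreasing⇒injective : ∀ {h : ℕ → ℕ} →
  (∀ {m n} → m ℕ.< n → h m ℕ.< h n) → Injective _≡_ _≡_ h
strictlyIncreasing⇒injective {h} increasing {m} {n} hm≡hn with ℕP.<-cmp m n
... | tri< m<n _ _ = ⊥-elim (ℕP.<-irrefl hm≡hn (increasing m<n))
... | tri≈ _ m≡n _ = m≡n
... | tri> _ _ n<m = ⊥-elim (ℕP.<-irrefl (sym hm≡hn) (increasing n<m))

stretch : ℕ → ℕ → ℕ
stretch zero    m = m + suc m
stretch (suc _) m = m

stretch-injective : ∀ i → Injective _≡_ _≡_ (stretch i)
stretch-injective zero    = strictlyIncreasing⇒injective
  (λ m<n → ℕP.+-mono-< m<n (s≤s m<n))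
stretch-injective (suc _) = λ m≡n → m≡n

F : Baire → Baire
F = coordinatewise stretch

constant : ℕ → Baire
constant b _ = b

stepAt : ℕ → ℕ → Baire
stepAt k b i = (suc i ∸ k) + b

constant-stepAt-firstDiff : ∀ k b → FirstDiff (constant b) (stepAt k b) k
constant-stepAt-firstDiff k b =
  (λ i i<k → sym (cong (_+ b) (ℕP.m≤n⇒m∸n≡0 i<k))) ,
  (λ b≡ → ℕP.1+n≢n (sym (trans b≡ (cong (_+ b) (ℕP.m+n∸n≡m 1 k)))))

F-not-uniformlyContinuous : ¬ UniformlyContinuous Dφ F
F-not-uniformlyContinuous uc with uc 1ℚ (*<* (+<+ (s≤s z≤n)))
... | δ , δ>0 , close⇒close with ½^-archimedean δ δ>0
... | b , ½^[1+b]<δ = ℚP.<-irrefl refl (subst (ℚ._< 1ℚ) (φ*½^n≡1 k) image<1)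
  where
    k = b + suc b
    x = constant b
    y = stepAt k b
    fd : FirstDiff x y k
    fd = constant-stepAt-firstDiff k b
    heads : x 0 ≡ y 0
    heads = proj₁ fd 0 (ℕP.≤-trans (s≤s z≤n) (ℕP.m≤n+m (suc b) b))
    image<1 : φ k * (½ ^ℚ k) ℚ.< 1ℚ
    image<1 = close⇒close x y _ _
      (dφ-equalHeads heads (dBar-firstDiff fd))
      (dφ-equalHeads (cong (stretch 0) heads)
        (dBar-firstDiff (coordinatewise-firstDiff stretch stretch-injective fd)))
      (subst (ℚ._< δ) (sym (φ*½^[m+n]≡½^n b (suc b))) ½^[1+b]<δ)

proposition3p4 : Σ (Baire → Baire) (λ f → Nonexpansive DBar f × ¬ UniformlyContinuous Dφ f)
proposition3p4 =
  F , coordinatewise-nonexpansive stretch stretch-injective , F-not-uniformlyContinuous
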